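{- Let $N=(P,T,F)$ be a Petri net, $m_{\mathrm{src}},m_{\mathrm{tgt}}\in\mathbb{R}_{\ge0}^P$ and $U\subseteq T$. If there exists an exclusion function for $U$, then $m_{\mathrm{tgt}}$ is not $U$-reachable from $m_{\mathrm{src}}$, i.e. there is no firing sequence with support exactly $U$ leading from $m_{\mathrm{src}}$ to $m_{\mathrm{tgt}}$.
   Context: A Petri net is $N=(P,T,F)$ with $P,T$ disjoint finite sets and $F=(F_-,F_+)$, $F_\pm\colon P\times T\to\mathbb{N}$. For $t\in T$, ${}^\bullet t:=F_-e_t$, $\Delta_t:=(F_+-F_-)e_t$. Markings are $m\in\mathbb{R}_{\ge0}^P$; for real $\alpha>0$, if $m\ge\alpha\,{}^\bullet t$ then $m\xrightarrow{\alpha t}m+\alpha\Delta_t$; $m\xrightarrow{t}m'$ means $m\xrightarrow{\alpha t}m'$ for some $\alpha>0$. A firing sequence $\alpha_1t_1\cdots\alpha_nt_n$ from $m_0$ to $m_n$ satisfies $m_0\xrightarrow{\alpha_1t_1}m_1\cdots\xrightarrow{\alpha_nt_n}m_n$; its support is $\{t_1,\dots,t_n\}$. Given $S\subseteq S'\subseteq T$, an exclusion function for $(S,S')$ (relative to $m_{\mathrm{src}},m_{\mathrm{tgt}}$) is a function $f\colon\mathbb{R}_{\ge0}^P\to\mathbb{R}$ such that (1) for all $t\in S'$, $m\xrightarrow{t}m'$ implies $f(m)\le f(m')$; and (2) either $f(m_{\mathrm{src}})>f(m_{\mathrm{tgt}})$, or $f(m_{\mathrm{src}})=f(m_{\mathrm{tgt}})$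 and there exists $t\in S$ such that $m\xrightarrow{t}m'$ implies $f(m)<f(m')$. An exclusion function for $S$ is an exclusion function for $(S,S)$. -}

module Defs where

open import Level using (Level; suc; _⊔_)
open import Data.Nat using (ℕ; zero) renaming (suc to sucℕ)
open import Data.Fin using (Fin)
open import Data.List using (List; []; _∷_)
open import Data.List.Relation.Unary.Any using (Any)
open import Data.Product using (Σ; ∃; _×_; _,_; proj₂)
open import Data.Sum using (_⊎_)
open import Relation.Binary.PropositionalEquality using (_≡_)
open import Relation.Nullary using (¬_)

-- The agda-stdlib has no real numbers, so the statement
-- is made for an arbitrary (linearly) ordered field K; the paper's case is
-- K = ℝ.

record OrderedField : Set₁ where
  infixl 6 _+_ _-_
  infixl 7 _*_
  infix 4 _≤_ _<_
  field
    Carrier : Set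
    0# 1# : Carrier
    _+_ _*_ : Carrier → Carrier → Carrier
    -_ : Carrier → Carrier
    _⁻¹ : (x : Carrier) → ¬ (x ≡ 0#) → Carrier
    _≤_ : Carrier → Carrier → Set
    +-assoc : ∀ x y z → (x + y) + z ≡ x + (y + z)
    +-comm : ∀ x y → x + y ≡ y + x
    +-identityˡ : ∀ x → 0# + x ≡ x
    -‿inverseˡ : ∀ x → (- x) + x ≡ 0#
    *-assoc : ∀ x y z → (x * y) * z ≡ x * (y * z)
    *-comm : ∀ x y → x * y ≡ y * x
    *-identityˡ : ∀ x → 1# * x ≡ x
    ⁻¹-inverseˡ : ∀ x (x≢0 : ¬ (x ≡ 0#)) → (x ⁻¹) x≢0 * x ≡ 1#
    distribˡ : ∀ x y z → x * (y + z) ≡ (x * y) + (x * z)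
    0≢1 : ¬ (0# ≡ 1#)
    ≤-refl : ∀ x → x ≤ x
    ≤-trans : ∀ {x y z} → x ≤ y → y ≤ z → x ≤ z
    ≤-antisym : ∀ {x y} → x ≤ y → y ≤ x → x ≡ y
    ≤-total : ∀ x y → x ≤ y ⊎ y ≤ x
    +-mono-≤ : ∀ {x y} z → x ≤ y → x + z ≤ y + z
    *-nonneg : ∀ {x y} → 0# ≤ x → 0# ≤ y → 0# ≤ x * y

  _-_ : Carrier → Carrier → Carrier
  x - y = x + (- y)

  _<_ : Carrier → Carrier → Set
  x < y = x ≤ y × ¬ (x ≡ y)

  fromℕ : ℕ → Carrier
  fromℕ zero = 0#
  fromℕ (sucℕ n) = 1# + fromℕ n

record PetriNet : Set where
  field
    places transitions : ℕ
    F₋ F₊ : Fin places → Fin transitions → ℕ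

module _ (K : OrderedField) (N : PetriNet) where
  open OrderedField K
  open PetriNet N

  Vector : Set
  Vector = Fin places → Carrier

  NonNeg : Vector → Set
  NonNeg m = ∀ p → 0# ≤ m p

  FiresAlpha : Vector → Carrier → Fin transitions → Vector → Set
  FiresAlpha m α t m' =
    0# < α × NonNeg m
    × (∀ p → α * fromℕ (F₋ p t) ≤ m p)
    × (∀ p → m' p ≡ m p + α * (fromℕ (F₊ p t) - fromℕ (F₋ p t)))

  Fires : Vector → Fin transitions → Vector → Set
  Fires m t m' = ∃ λ α → FiresAlpha m α t m'

  Sequence : Set
  Sequence = List (Carrier × Fin transitions)

  FiringSeq : Vector → Sequence → Vector → Set
  FiringSeq m [] m' = m ≡ m'
  FiringSeq m ((α , t) ∷ σ) m'' = ∃ λ m' → FiresAlpha m α t m' × FiringSeq m' σ m''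

  InSupport : Fin transitions → Sequence → Set
  InSupport t σ = Any (λ at → proj₂ at ≡ t) σ

  Subset : Set₁
  Subset = Fin transitions → Set

  SupportIs : Sequence → Subset → Set
  SupportIs σ U = ∀ t → (InSupport t σ → U t) × (U t → InSupport t σ)

  Reachable : Subset → Vector → Vector → Set
  Reachable U src tgt = ∃ λ σ → FiringSeq src σ tgt × SupportIs σ U

  -- exclusion function for (S, S') relative to src, tgt.
  -- f is defined on ℝ≥0^P; here f is given on all of K^P but only its
  -- values on markings matter (Fires forces nonnegativity of m, and m'
  -- is then nonnegative as well).
  IsExclusionFunction : Subset → Subset → Vector → Vector → (Vector → Carrier) → Set
  IsExclusionFunction S S' src tgt f =
    (∀ t → S' t → ∀ m m' → Fires m t m' → f m ≤ f m')
    × (f tgt < f src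
       ⊎ (f src ≡ f tgt × ∃ λ t → S t × (∀ m m' → Fires m t m' → f m < f m')))

  IsExclusionFunctionFor : Subset → Vector → Vector → (Vector → Carrier) → Set
  IsExclusionFunctionFor U = IsExclusionFunction U U

{-# OPTIONS --safe #-}
module Submission where

open import Defs
open import Data.Fin using (Fin)
open import Data.Product using (∃; _,_; proj₁; proj₂)
open import Data.Sum using (inj₁; inj₂)
open import Data.List using ([]; _∷_)
open import Data.List.Relation.Unary.Any using (here; there)
open import Data.Empty using (⊥)
open import Relation.Nullary using (¬_)
open import Relation.Binary.PropositionalEquality using (refl; sym; subst)

-- Along any firing sequence whose support lies in S', an exclusion function f for (S, S')
-- can only grow, and it grows strictly as soon as the strictly increasing transition of S
-- occurs.  Hence f src ≤ f tgt for every such sequence, with strict inequality when the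
-- support also contains S; both alternatives of the exclusion condition contradict this.

module _ (K : OrderedField) where
  open OrderedField K

  <-≤-trans : ∀ {x y z} → x < y → y ≤ z → x < z
  <-≤-trans (x≤y , x≢y) y≤z =
    ≤-trans x≤y y≤z , λ x≡z → x≢y (≤-antisym x≤y (subst (_ ≤_) (sym x≡z) y≤z))

  ≤-<-trans : ∀ {x y z} → x ≤ y → y < z → x < z
  ≤-<-trans x≤y (y≤z , y≢z) =
    ≤-trans x≤y y≤z , λ x≡z → y≢z (≤-antisym y≤z (subst (_≤ _) x≡z x≤y))

  ≤⇒≯ : ∀ {x y} → x ≤ y → ¬ (y < x)
  ≤⇒≯ x≤y (y≤x , y≢x) = y≢x (≤-antisym y≤x x≤y)

module _ (K : OrderedField) (N : PetriNet) where
  open OrderedField K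
  open PetriNet N

  SupportWithin : Sequence K N → Subset K N → Set
  SupportWithin σ S = ∀ t → InSupport K N t σ → S t

  Increasing : (Vector K N → Carrier) → Fin transitions → Set
  Increasing f t = ∀ m m' → Fires K N m t m' → f m ≤ f m'

  StrictlyIncreasing : (Vector K N → Carrier) → Fin transitions → Set
  StrictlyIncreasing f t = ∀ m m' → Fires K N m t m' → f m < f m'

  module _ {S' : Subset K N} {f : Vector K N → Carrier}
           (increasing : ∀ t → S' t → Increasing f t) where

    FiringSeq-increasing : ∀ {m m'} σ → FiringSeq K N m σ m' → SupportWithin σ S' →
                           f m ≤ f m'
    FiringSeq-increasing {m} [] refl _ = ≤-refl (f m)
    FiringSeq-increasing ((α , t) ∷ σ) (_ , m→ , σ↠) ⊆S' =
      ≤-trans (increasing t (⊆S' t (here refl)) _ _ (α , m→))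
              (FiringSeq-increasing σ σ↠ (λ u u∈σ → ⊆S' u (there u∈σ)))

    FiringSeq-strictlyIncreasing : ∀ {m m' t} σ → FiringSeq K N m σ m' →
                                   SupportWithin σ S' → StrictlyIncreasing f t →
                                   InSupport K N t σ → f m < f m'
    FiringSeq-strictlyIncreasing ((α , _) ∷ σ) (_ , m→ , σ↠) ⊆S' strict (here refl) =
      <-≤-trans K (strict _ _ (α , m→))
                  (FiringSeq-increasing σ σ↠ (λ u u∈σ → ⊆S' u (there u∈σ)))
    FiringSeq-strictlyIncreasing ((α , t) ∷ σ) (_ , m→ , σ↠) ⊆S' strict (there t∈σ) =
      ≤-<-trans K (increasing t (⊆S' t (here refl)) _ _ (α , m→))
                  (FiringSeq-strictlyIncreasing σ σ↠ (λ u u∈σ → ⊆S' u (there u∈σ)) strict t∈σ)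

  exclusion⇒¬FiringSeq : ∀ {S S' src tgt f} → IsExclusionFunction K N S S' src tgt f →
                          ∀ σ → FiringSeq K N src σ tgt → SupportWithin σ S' →
                          (∀ t → S t → InSupport K N t σ) → ⊥
  exclusion⇒¬FiringSeq (increasing , inj₁ tgt<src) σ σ↠ ⊆S' _ =
    ≤⇒≯ K (FiringSeq-increasing increasing σ σ↠ ⊆S') tgt<src
  exclusion⇒¬FiringSeq (increasing , inj₂ (src≡tgt , t , t∈S , strict)) σ σ↠ ⊆S' S⊆ =
    proj₂ (FiringSeq-strictlyIncreasing increasing σ σ↠ ⊆S' strict (S⊆ t t∈S)) src≡tgt

lemma3p4 : (K : OrderedField) (N : PetriNet)
    → (src tgt : Vector K N) → NonNeg K N src → NonNeg K N tgt
    → (U : Subset K N)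
    → (∃ λ f → IsExclusionFunctionFor K N U src tgt f)
    → ¬ Reachable K N U src tgt
lemma3p4 K N _ _ _ _ _ (_ , exclusion) (σ , σ↠ , support) =
  exclusion⇒¬FiringSeq K N exclusion σ σ↠ (λ t → proj₁ (support t)) (λ t → proj₂ (support t))
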